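{- Fix $d\ge3$. There is a function $f(n)=o(n^{2d})$ as $n\to\infty$ such that every $d$-dimensional latin hypercube of order $n$ contains at least $\left(\frac{d(d-1)}{2}+d+1\right)n^{2d}+f(n)$ cuboctahedra.
   Context: A $d$-dimensional latin hypercube of order $n$ is an array $Q=(q_\alpha)$ indexed by $\alpha\in\{0,\ldots,n-1\}^d$ with entries in $\{0,\ldots,n-1\}$ such that any two indices differing in exactly one coordinate carry different symbols. A cuboctahedron in $Q$ is a tuple consisting of $d$ ordered pairs $(a^i_1,a^i_2)$ and $d$ ordered pairs $(b^i_1,b^i_2)$, $i=1,\ldots,d$, of elements of $\{0,\ldots,n-1\}$, such that $q_{a^1_{j_1},\ldots,a^d_{j_d}}=q_{b^1_{j_1},\ldots,b^d_{j_d}}$ for all $j_1,\ldots,j_d\in\{1,2\}$; cuboctahedra are counted as such tuples. -}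

module Defs where

open import Data.Nat using (ℕ; zero; suc; _+_; _*_; _∸_; _^_)
import Data.Nat
open import Data.Fin using (Fin; zero; suc)
open import Data.Fin.Properties using (all?; _≟_)
open import Data.Vec using (Vec; []; _∷_; lookup; tabulate; _[_]≔_)
open import Data.List using (List; []; _∷_; map; concatMap; length; filter; allFin)
open import Data.Product using (_×_; _,_; ∃)
open import Data.Integer using (+_)
open import Data.Rational using (ℚ; 0ℚ; _/_; ∣_∣)
import Data.Rational as ℚ
open import Relation.Nullary using (Dec; yes; no; ¬_)
open import Relation.Nullary.Decidable using (map′)
open import Relation.Binary.PropositionalEquality using (_≡_; _≢_)

Index : ℕ → ℕ → Set
Index d n = Vec (Fin n) d

Array : ℕ → ℕ → Set
Array d n = Index d n → Fin n

IsLatinHypercube : (d n : ℕ) → Array d n → Set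
IsLatinHypercube d n Q =
  ∀ (α : Index d n) (i : Fin d) (x : Fin n) → x ≢ lookup α i → Q α ≢ Q (α [ i ]≔ x)

choose : {A : Set} → Fin 2 → A → A → A
choose zero    a₁ a₂ = a₁
choose (suc _) a₁ a₂ = a₂

vertex : {d n : ℕ} → Vec (Fin n) d → Vec (Fin n) d → Vec (Fin 2) d → Index d n
vertex a₁ a₂ j = tabulate (λ i → choose (lookup j i) (lookup a₁ i) (lookup a₂ i))

-- A candidate cuboctahedron: (a^i_1)_i, (a^i_2)_i, (b^i_1)_i, (b^i_2)_i
Quad : ℕ → ℕ → Set
Quad d n = Vec (Fin n) d × Vec (Fin n) d × Vec (Fin n) d × Vec (Fin n) d

IsCuboctahedron : {d n : ℕ} → Array d n → Quad d n → Set
IsCuboctahedron {d} Q (a₁ , a₂ , b₁ , b₂) =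
  ∀ (j : Vec (Fin 2) d) → Q (vertex a₁ a₂ j) ≡ Q (vertex b₁ b₂ j)

allVec? : {k : ℕ} (d : ℕ) {P : Vec (Fin k) d → Set} →
          ((v : Vec (Fin k) d) → Dec (P v)) → Dec ((v : Vec (Fin k) d) → P v)
allVec? zero    P? = map′ (λ p → λ { [] → p }) (λ h → h []) (P? [])
allVec? (suc d) P? =
  map′ (λ h → λ { (x ∷ v) → h x v }) (λ h x v → h (x ∷ v))
       (all? (λ x → allVec? d (λ v → P? (x ∷ v))))

isCuboctahedron? : {d n : ℕ} (Q : Array d n) (t : Quad d n) → Dec (IsCuboctahedron Q t)
isCuboctahedron? {d} Q (a₁ , a₂ , b₁ , b₂) =
  allVec? d (λ j → Q (vertex a₁ a₂ j) ≟ Q (vertex b₁ b₂ j))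

allVecs : (d n : ℕ) → List (Vec (Fin n) d)
allVecs zero    n = [] ∷ []
allVecs (suc d) n = concatMap (λ x → map (x ∷_) (allVecs d n)) (allFin n)

allQuads : (d n : ℕ) → List (Quad d n)
allQuads d n =
  concatMap (λ a₁ → concatMap (λ a₂ → concatMap (λ b₁ → map (λ b₂ → (a₁ , a₂ , b₁ , b₂))
    (allVecs d n)) (allVecs d n)) (allVecs d n)) (allVecs d n)

numCuboctahedra : {d n : ℕ} → Array d n → ℕ
numCuboctahedra {d} {n} Q = length (filter (isCuboctahedron? Q) (allQuads d n))

toℚ : ℕ → ℚ
toℚ m = + m / 1

IsLittleO : (ℕ → ℚ) → ℕ → Set
IsLittleO f k = ∀ (ε : ℚ) → 0ℚ ℚ.< ε → ∃ λ N → ∀ n → N Data.Nat.≤ n → ∣ f n ∣ ℚ.≤ ε ℚ.* toℚ (n ^ k)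

cuboConst : ℕ → ℚ
cuboConst d = (+ (d * (d ∸ 1)) / 2) ℚ.+ toℚ (d + 1)

-- A cuboctahedron is a pair of boxes (a₁, a₂), (b₁, b₂) on whose corresponding vertices
-- Q agrees.  Classify boxes by their shape σ ∈ {0,1}^d, with σᵢ = 1 iff a₁ᵢ ≠ a₂ᵢ: there are
-- B = n^d (n-1)^|σ| boxes of shape σ, and their vertices carry at most 2^|σ| distinct
-- values of Q.  Two boxes of shape σ showing the same values there form a cuboctahedron, so
-- by Cauchy–Schwarz at least B² / n^(2^|σ|) cuboctahedra have both boxes of shape σ, and
-- taking the two boxes equal gives at least B of them.  For |σ| ∈ {1, 2} the first bound and
-- for |σ| = d the second is n^(2d) - O(n^(2d-1)); for d ≥ 3 these are d + d(d-1)/2 + 1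
-- distinct shapes.
module Submission where

open import Defs

module FiniteSums where

  open import Data.Nat using (ℕ; suc; _+_; _*_; _≤_; z≤n)
  import Data.Nat as ℕ
  open import Data.Nat.Properties
  open import Data.Nat.Tactic.RingSolver using (solve-∀)
  open import Data.List using (List; []; _∷_; _++_; map; concatMap; length; filter)
  open import Data.Product using (_,_)
  open import Data.Sum using (inj₁; inj₂)
  open import Function using (_∘_)
  open import Relation.Nullary using (Dec; yes; no; ¬_; contradiction)
  open import Relation.Nullary.Decidable using (_×-dec_)
  open import Relation.Binary.Definitions using (DecidableEquality)
  open import Relation.Binary.PropositionalEquality

  private
    variable
      A B P R : Set

  𝟙 : Dec P → ℕ
  𝟙 (yes _) = 1
  𝟙 (no _)  = 0

  𝟙-yes : P → (p : Dec P) → 𝟙 p ≡ 1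
  𝟙-yes x (yes _) = refl
  𝟙-yes x (no ¬x) = contradiction x ¬x

  𝟙-no : ¬ P → (p : Dec P) → 𝟙 p ≡ 0
  𝟙-no ¬x (yes x) = contradiction x ¬x
  𝟙-no ¬x (no _)  = refl

  𝟙*-≤ : (p : Dec P) (m : ℕ) → 𝟙 p * m ≤ m
  𝟙*-≤ (yes _) m = ≤-reflexive (*-identityˡ m)
  𝟙*-≤ (no _)  m = z≤n

  𝟙-cong : (P → R) → (R → P) → (p : Dec P) (r : Dec R) → 𝟙 p ≡ 𝟙 r
  𝟙-cong f g (yes x) r = sym (𝟙-yes (f x) r)
  𝟙-cong f g (no ¬x) r = sym (𝟙-no (¬x ∘ g) r)

  𝟙-×-dec : (p : Dec P) (r : Dec R) → 𝟙 (p ×-dec r) ≡ 𝟙 p * 𝟙 r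
  𝟙-×-dec (yes _) (yes _) = refl
  𝟙-×-dec (yes _) (no _)  = refl
  𝟙-×-dec (no _)  _       = refl

  𝟙*-mono-≤ : ∀ {m k} → (P → m ≤ k) → (p : Dec P) → 𝟙 p * m ≤ 𝟙 p * k
  𝟙*-mono-≤ m≤k (yes x) = *-monoʳ-≤ 1 (m≤k x)
  𝟙*-mono-≤ m≤k (no _)  = z≤n

  𝟙-≟-disjoint : ∀ {a b c} → a ≢ b → a ≢ c → b ≢ c → ∀ w → 𝟙 (w ℕ.≟ a) + 𝟙 (w ℕ.≟ b) + 𝟙 (w ℕ.≟ c) ≤ 1
  𝟙-≟-disjoint {a} {b} {c} a≢b a≢c b≢c w with w ℕ.≟ a | w ℕ.≟ b | w ℕ.≟ c
  ... | yes refl | yes refl | _        = contradiction refl a≢b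
  ... | yes refl | _        | yes refl = contradiction refl a≢c
  ... | _        | yes refl | yes refl = contradiction refl b≢c
  ... | yes _    | no _     | no _     = ≤-refl
  ... | no _     | yes _    | no _     = ≤-refl
  ... | no _     | no _     | yes _    = ≤-refl
  ... | no _     | no _     | no _     = z≤n

  ∑ : List A → (A → ℕ) → ℕ
  ∑ []       f = 0
  ∑ (x ∷ xs) f = f x + ∑ xs f

  syntax ∑ xs (λ x → e) = ∑[ x ∈ xs ] e

  ∑-cong : (xs : List A) {f g : A → ℕ} → (∀ x → f x ≡ g x) → ∑ xs f ≡ ∑ xs g
  ∑-cong []       f≗g = refl
  ∑-cong (x ∷ xs) f≗g = cong₂ _+_ (f≗g x) (∑-cong xs f≗g)

  ∑-mono-≤ : (xs : List A) {f g : A → ℕ} → (∀ x → f x ≤ g x) → ∑ xs f ≤ ∑ xs g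
  ∑-mono-≤ []       f≤g = z≤n
  ∑-mono-≤ (x ∷ xs) f≤g = +-mono-≤ (f≤g x) (∑-mono-≤ xs f≤g)

  ∑-++ : (xs ys : List A) (f : A → ℕ) → ∑ (xs ++ ys) f ≡ ∑ xs f + ∑ ys f
  ∑-++ []       ys f = refl
  ∑-++ (x ∷ xs) ys f = trans (cong (f x +_) (∑-++ xs ys f)) (sym (+-assoc (f x) _ _))

  ∑-zero : (xs : List A) → ∑[ x ∈ xs ] 0 ≡ 0
  ∑-zero []       = refl
  ∑-zero (x ∷ xs) = ∑-zero xs

  ∑-const : (xs : List A) (c : ℕ) → ∑[ x ∈ xs ] c ≡ length xs * c
  ∑-const []       c = refl
  ∑-const (x ∷ xs) c = cong (c +_) (∑-const xs c)

  ∑-distrib-+ : (xs : List A) (f g : A → ℕ) → ∑[ x ∈ xs ] (f x + g x) ≡ ∑ xs f + ∑ xs g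
  ∑-distrib-+ []       f g = refl
  ∑-distrib-+ (x ∷ xs) f g rewrite ∑-distrib-+ xs f g = +-interchange (f x) (g x) (∑ xs f) (∑ xs g)
    where
    +-interchange : ∀ a b c d → a + b + (c + d) ≡ a + c + (b + d)
    +-interchange = solve-∀

  *-distribˡ-∑ : (c : ℕ) (xs : List A) (f : A → ℕ) → c * ∑ xs f ≡ ∑[ x ∈ xs ] (c * f x)
  *-distribˡ-∑ c []       f = *-zeroʳ c
  *-distribˡ-∑ c (x ∷ xs) f = trans (*-distribˡ-+ c (f x) (∑ xs f)) (cong (c * f x +_) (*-distribˡ-∑ c xs f))

  *-distribʳ-∑ : (c : ℕ) (xs : List A) (f : A → ℕ) → ∑ xs f * c ≡ ∑[ x ∈ xs ] (f x * c)
  *-distribʳ-∑ c xs f = trans (*-comm (∑ xs f) c)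
    (trans (*-distribˡ-∑ c xs f) (∑-cong xs (λ x → *-comm c (f x))))

  ∑-comm : (xs : List A) (ys : List B) (f : A → B → ℕ) →
           ∑[ x ∈ xs ] ∑[ y ∈ ys ] f x y ≡ ∑[ y ∈ ys ] ∑[ x ∈ xs ] f x y
  ∑-comm []       ys f = sym (∑-zero ys)
  ∑-comm (x ∷ xs) ys f rewrite ∑-comm xs ys f = sym (∑-distrib-+ ys (f x) (λ y → ∑[ x ∈ xs ] f x y))

  ∑-map : (g : A → B) (xs : List A) (f : B → ℕ) → ∑ (map g xs) f ≡ ∑ xs (f ∘ g)
  ∑-map g []       f = refl
  ∑-map g (x ∷ xs) f = cong (f (g x) +_) (∑-map g xs f)

  ∑-concatMap : (g : A → List B) (xs : List A) (f : B → ℕ) →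
                ∑ (concatMap g xs) f ≡ ∑[ x ∈ xs ] ∑ (g x) f
  ∑-concatMap g []       f = refl
  ∑-concatMap g (x ∷ xs) f =
    trans (∑-++ (g x) (concatMap g xs) f) (cong (∑ (g x) f +_) (∑-concatMap g xs f))

  length-filter≡∑𝟙 : {P : A → Set} (P? : ∀ x → Dec (P x)) (xs : List A) →
                     length (filter P? xs) ≡ ∑[ x ∈ xs ] 𝟙 (P? x)
  length-filter≡∑𝟙 P? []       = refl
  length-filter≡∑𝟙 P? (x ∷ xs) with P? x
  ... | yes _ = cong suc (length-filter≡∑𝟙 P? xs)
  ... | no _  = length-filter≡∑𝟙 P? xs

  ∑-𝟙-bound : ∀ {P : A → Set} (P? : ∀ x → Dec (P x)) (xs : List A) {F : A → ℕ} {X Z : ℕ} →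
              (∀ x → P x → X ≤ F x + Z) →
              ∑[ x ∈ xs ] 𝟙 (P? x) * X ≤ ∑[ x ∈ xs ] (𝟙 (P? x) * F x) + ∑[ x ∈ xs ] 𝟙 (P? x) * Z
  ∑-𝟙-bound P? xs {F} {X} {Z} bound = begin
    ∑[ x ∈ xs ] 𝟙 (P? x) * X                                    ≡⟨ *-distribʳ-∑ X xs _ ⟩
    ∑[ x ∈ xs ] (𝟙 (P? x) * X)                                  ≤⟨ ∑-mono-≤ xs (λ x → 𝟙*-mono-≤ (bound x) (P? x)) ⟩
    ∑[ x ∈ xs ] (𝟙 (P? x) * (F x + Z))                          ≡⟨ ∑-cong xs (λ x → *-distribˡ-+ (𝟙 (P? x)) (F x) Z) ⟩
    ∑[ x ∈ xs ] (𝟙 (P? x) * F x + 𝟙 (P? x) * Z)                 ≡⟨ ∑-distrib-+ xs _ _ ⟩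
    ∑[ x ∈ xs ] (𝟙 (P? x) * F x) + ∑[ x ∈ xs ] (𝟙 (P? x) * Z)   ≡⟨ cong (∑[ x ∈ xs ] (𝟙 (P? x) * F x) +_) (*-distribʳ-∑ Z xs _) ⟨
    ∑[ x ∈ xs ] (𝟙 (P? x) * F x) + ∑[ x ∈ xs ] 𝟙 (P? x) * Z     ∎
    where open ≤-Reasoning

  module _ (_≟_ : DecidableEquality A) where

    record IsEnumeration (xs : List A) : Set where
      constructor multiplicity-one
      field
        multiplicity : ∀ u → ∑[ p ∈ xs ] 𝟙 (u ≟ p) ≡ 1

    module _ {xs : List A} (enum : IsEnumeration xs) where

      open IsEnumeration enum

      ∑-delta : ∀ u (g : A → ℕ) → ∑[ p ∈ xs ] (𝟙 (u ≟ p) * g p) ≡ g u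
      ∑-delta u g = begin
        ∑[ p ∈ xs ] (𝟙 (u ≟ p) * g p)  ≡⟨ ∑-cong xs at-u ⟩
        ∑[ p ∈ xs ] (𝟙 (u ≟ p) * g u)  ≡⟨ *-distribʳ-∑ (g u) xs _ ⟨
        ∑[ p ∈ xs ] 𝟙 (u ≟ p) * g u    ≡⟨ cong (_* g u) (multiplicity u) ⟩
        1 * g u                         ≡⟨ *-identityˡ (g u) ⟩
        g u                             ∎
        where
        open ≡-Reasoning
        at-u : ∀ p → 𝟙 (u ≟ p) * g p ≡ 𝟙 (u ≟ p) * g u
        at-u p with u ≟ p
        ... | yes refl = refl
        ... | no _     = refl

      term-≤-∑ : ∀ u (g : A → ℕ) → g u ≤ ∑ xs g
      term-≤-∑ u g = begin
        g u                            ≡⟨ ∑-delta u g ⟨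
        ∑[ p ∈ xs ] (𝟙 (u ≟ p) * g p)  ≤⟨ ∑-mono-≤ xs (λ p → 𝟙*-≤ (u ≟ p) (g p)) ⟩
        ∑ xs g                         ∎
        where open ≤-Reasoning

  ∑-product : (xs : List A) (ys : List B) (f : A → ℕ) (g : B → ℕ) →
              ∑ xs f * ∑ ys g ≡ ∑[ x ∈ xs ] ∑[ y ∈ ys ] (f x * g y)
  ∑-product xs ys f g = trans (*-distribʳ-∑ (∑ ys g) xs f)
    (∑-cong xs (λ x → *-distribˡ-∑ (f x) ys g))

  2*m*n≤m*m+n*n : ∀ m n → 2 * (m * n) ≤ m * m + n * n
  2*m*n≤m*m+n*n m n with ≤-total m n
  ... | inj₁ m≤n with m≤n⇒∃[o]m+o≡n m≤n
  ...   | o , refl = subst (2 * (m * (m + o)) ≤_) (expand m o) (m≤m+n _ (o * o))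
    where
    expand : ∀ m o → 2 * (m * (m + o)) + o * o ≡ m * m + (m + o) * (m + o)
    expand = solve-∀
  2*m*n≤m*m+n*n m n | inj₂ n≤m with m≤n⇒∃[o]m+o≡n n≤m
  ...   | o , refl = subst (2 * ((n + o) * n) ≤_) (expand n o) (m≤m+n _ (o * o))
    where
    expand : ∀ n o → 2 * ((n + o) * n) + o * o ≡ (n + o) * (n + o) + n * n
    expand = solve-∀

  -- 2 (∑ f)² = ∑∑ 2 f(x) f(y) ≤ ∑∑ (f(x)² + f(y)²) = 2 |xs| ∑ f².
  cauchy-schwarz : (xs : List A) (f : A → ℕ) → ∑ xs f * ∑ xs f ≤ length xs * ∑[ x ∈ xs ] (f x * f x)
  cauchy-schwarz xs f = *-cancelˡ-≤ 2 (begin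
    2 * (∑ xs f * ∑ xs f)                                    ≡⟨ cong (2 *_) (∑-product xs xs f f) ⟩
    2 * ∑[ x ∈ xs ] ∑[ y ∈ xs ] (f x * f y)                  ≡⟨ *-distribˡ-∑ 2 xs _ ⟩
    ∑[ x ∈ xs ] (2 * ∑[ y ∈ xs ] (f x * f y))                ≡⟨ ∑-cong xs (λ x → *-distribˡ-∑ 2 xs _) ⟩
    ∑[ x ∈ xs ] ∑[ y ∈ xs ] (2 * (f x * f y))                ≤⟨ ∑-mono-≤ xs (λ x → ∑-mono-≤ xs (λ y → 2*m*n≤m*m+n*n (f x) (f y))) ⟩
    ∑[ x ∈ xs ] ∑[ y ∈ xs ] (f x * f x + f y * f y)          ≡⟨ ∑-cong xs (λ x → ∑-distrib-+ xs _ _) ⟩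
    ∑[ x ∈ xs ] (∑[ y ∈ xs ] (f x * f x) + S)                ≡⟨ ∑-distrib-+ xs _ _ ⟩
    ∑[ x ∈ xs ] ∑[ y ∈ xs ] (f x * f x) + ∑[ x ∈ xs ] S      ≡⟨ cong₂ _+_ (∑-cong xs (λ x → ∑-const xs _)) (∑-const xs S) ⟩
    ∑[ x ∈ xs ] (length xs * (f x * f x)) + length xs * S    ≡⟨ cong (_+ length xs * S) (*-distribˡ-∑ (length xs) xs _) ⟨
    length xs * S + length xs * S                            ≡⟨ double (length xs * S) ⟩
    2 * (length xs * S)                                      ∎)
    where
    open ≤-Reasoning
    S : ℕ
    S = ∑[ x ∈ xs ] (f x * f x)
    double : ∀ m → m + m ≡ 2 * m
    double = solve-∀

  module _ (_≟_ : DecidableEquality B) {ps : List B} (enum : IsEnumeration _≟_ ps)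
           (xs : List A) (w : A → ℕ) (φ : A → B) where

    fibre : B → ℕ
    fibre p = ∑[ a ∈ xs ] (w a * 𝟙 (φ a ≟ p))

    collisions : ℕ
    collisions = ∑[ a ∈ xs ] ∑[ b ∈ xs ] (w a * w b * 𝟙 (φ a ≟ φ b))

    ∑-fibre : ∑ ps fibre ≡ ∑ xs w
    ∑-fibre = begin
      ∑[ p ∈ ps ] ∑[ a ∈ xs ] (w a * 𝟙 (φ a ≟ p))  ≡⟨ ∑-comm ps xs _ ⟩
      ∑[ a ∈ xs ] ∑[ p ∈ ps ] (w a * 𝟙 (φ a ≟ p))  ≡⟨ ∑-cong xs (λ a → *-distribˡ-∑ (w a) ps _) ⟨
      ∑[ a ∈ xs ] (w a * ∑[ p ∈ ps ] 𝟙 (φ a ≟ p))  ≡⟨ ∑-cong xs (λ a → cong (w a *_) (IsEnumeration.multiplicity enum (φ a))) ⟩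
      ∑[ a ∈ xs ] (w a * 1)                         ≡⟨ ∑-cong xs (λ a → *-identityʳ (w a)) ⟩
      ∑ xs w                                        ∎
      where open ≡-Reasoning

    ∑-fibre² : ∑[ p ∈ ps ] (fibre p * fibre p) ≡ collisions
    ∑-fibre² = begin
      ∑[ p ∈ ps ] (fibre p * fibre p)
        ≡⟨ ∑-cong ps (λ p → ∑-product xs xs _ _) ⟩
      ∑[ p ∈ ps ] ∑[ a ∈ xs ] ∑[ b ∈ xs ] (w a * 𝟙 (φ a ≟ p) * (w b * 𝟙 (φ b ≟ p)))
        ≡⟨ trans (∑-comm ps xs _) (∑-cong xs (λ a → ∑-comm ps xs _)) ⟩
      ∑[ a ∈ xs ] ∑[ b ∈ xs ] ∑[ p ∈ ps ] (w a * 𝟙 (φ a ≟ p) * (w b * 𝟙 (φ b ≟ p)))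
        ≡⟨ ∑-cong xs (λ a → ∑-cong xs (λ b → ∑-cong ps (λ p → regroup (w a) (w b) _ _))) ⟩
      ∑[ a ∈ xs ] ∑[ b ∈ xs ] ∑[ p ∈ ps ] (w a * w b * (𝟙 (φ a ≟ p) * 𝟙 (φ b ≟ p)))
        ≡⟨ ∑-cong xs (λ a → ∑-cong xs (λ b → *-distribˡ-∑ (w a * w b) ps _)) ⟨
      ∑[ a ∈ xs ] ∑[ b ∈ xs ] (w a * w b * ∑[ p ∈ ps ] (𝟙 (φ a ≟ p) * 𝟙 (φ b ≟ p)))
        ≡⟨ ∑-cong xs (λ a → ∑-cong xs (λ b → cong (w a * w b *_) (coincide a b))) ⟩
      collisions
        ∎
      where
      open ≡-Reasoning
      regroup : ∀ x y u v → x * u * (y * v) ≡ x * y * (u * v)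
      regroup = solve-∀
      coincide : ∀ a b → ∑[ p ∈ ps ] (𝟙 (φ a ≟ p) * 𝟙 (φ b ≟ p)) ≡ 𝟙 (φ a ≟ φ b)
      coincide a b = trans (∑-delta _≟_ enum (φ a) (λ p → 𝟙 (φ b ≟ p))) (𝟙-cong sym sym (φ b ≟ φ a) (φ a ≟ φ b))

    collision-bound : ∑ xs w * ∑ xs w ≤ length ps * collisions
    collision-bound = begin
      ∑ xs w * ∑ xs w                              ≡⟨ cong₂ _*_ ∑-fibre ∑-fibre ⟨
      ∑ ps fibre * ∑ ps fibre                      ≤⟨ cauchy-schwarz ps fibre ⟩
      length ps * ∑[ p ∈ ps ] (fibre p * fibre p)  ≡⟨ cong (length ps *_) ∑-fibre² ⟩
      length ps * collisions                       ∎
      where open ≤-Reasoning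

module Enumerations where

  open FiniteSums

  open import Data.Nat using (ℕ; zero; suc; _+_; _*_; _^_)
  open import Data.Nat.Properties
  open import Data.Fin using (Fin; zero; suc)
  import Data.Fin.Properties as Fin
  open import Data.List using (length; allFin)
  open import Data.List.Properties using (map-tabulate; length-tabulate)
  open import Data.Vec using (Vec; []; _∷_)
  import Data.Vec.Properties as Vec
  open import Data.Product using (_,_)
  open import Function using (id)
  open import Relation.Nullary.Decidable using (_×-dec_)
  open import Relation.Binary.Definitions using (DecidableEquality)
  open import Relation.Binary.PropositionalEquality

  ∑-allFin-suc : ∀ n (f : Fin (suc n) → ℕ) → ∑ (allFin (suc n)) f ≡ f zero + ∑[ x ∈ allFin n ] f (suc x)
  ∑-allFin-suc n f = cong (f zero +_)
    (trans (cong (λ xs → ∑ xs f) (sym (map-tabulate id suc))) (∑-map suc (allFin n) f))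

  allFin-multiplicity : ∀ n (u : Fin n) → ∑[ p ∈ allFin n ] 𝟙 (u Fin.≟ p) ≡ 1
  allFin-multiplicity (suc n) u@zero = begin
    ∑[ p ∈ allFin (suc n) ] 𝟙 (u Fin.≟ p)                 ≡⟨ ∑-allFin-suc n (λ p → 𝟙 (u Fin.≟ p)) ⟩
    𝟙 (u Fin.≟ u) + ∑[ p ∈ allFin n ] 𝟙 (u Fin.≟ suc p)
      ≡⟨ cong₂ _+_ (𝟙-yes refl (u Fin.≟ u)) (trans (∑-cong (allFin n) (λ p → 𝟙-no (λ ()) (u Fin.≟ suc p))) (∑-zero (allFin n))) ⟩
    1                                                     ∎
    where open ≡-Reasoning
  allFin-multiplicity (suc n) (suc u) = begin
    ∑[ p ∈ allFin (suc n) ] 𝟙 (suc u Fin.≟ p)                    ≡⟨ ∑-allFin-suc n (λ p → 𝟙 (suc u Fin.≟ p)) ⟩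
    𝟙 (suc u Fin.≟ zero) + ∑[ p ∈ allFin n ] 𝟙 (suc u Fin.≟ suc p)
      ≡⟨ cong₂ _+_ (𝟙-no (λ ()) (suc u Fin.≟ zero)) (∑-cong (allFin n) (λ p → 𝟙-cong Fin.suc-injective (cong suc) (suc u Fin.≟ suc p) (u Fin.≟ p))) ⟩
    ∑[ p ∈ allFin n ] 𝟙 (u Fin.≟ p)                              ≡⟨ allFin-multiplicity n u ⟩
    1                                                            ∎
    where open ≡-Reasoning

  allFin-isEnumeration : ∀ n → IsEnumeration Fin._≟_ (allFin n)
  allFin-isEnumeration n = multiplicity-one (allFin-multiplicity n)

  infix 4 _≟ᵛ_
  _≟ᵛ_ : ∀ {d n} → DecidableEquality (Vec (Fin n) d)
  _≟ᵛ_ = Vec.≡-dec Fin._≟_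

  𝟙-∷ : ∀ {d n} (x y : Fin n) (u v : Vec (Fin n) d) → 𝟙 (x ∷ u ≟ᵛ y ∷ v) ≡ 𝟙 (x Fin.≟ y) * 𝟙 (u ≟ᵛ v)
  𝟙-∷ x y u v = trans (𝟙-cong Vec.∷-injective (λ (x≡y , u≡v) → cong₂ _∷_ x≡y u≡v) (x ∷ u ≟ᵛ y ∷ v) (x Fin.≟ y ×-dec u ≟ᵛ v))
                      (𝟙-×-dec (x Fin.≟ y) (u ≟ᵛ v))

  ∑-allVecs-suc : ∀ d n (f : Vec (Fin n) (suc d) → ℕ) →
                  ∑ (allVecs (suc d) n) f ≡ ∑[ x ∈ allFin n ] ∑[ v ∈ allVecs d n ] f (x ∷ v)
  ∑-allVecs-suc d n f = trans (∑-concatMap _ (allFin n) f) (∑-cong (allFin n) (λ x → ∑-map (x ∷_) (allVecs d n) f))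

  length-allVecs : ∀ d n → length (allVecs d n) ≡ n ^ d
  length-allVecs d n = trans (sym (*-identityʳ _)) (trans (sym (∑-const (allVecs d n) 1)) (count d))
    where
    count : ∀ d → ∑[ v ∈ allVecs d n ] 1 ≡ n ^ d
    count zero    = refl
    count (suc d) = begin
      ∑[ v ∈ allVecs (suc d) n ] 1                 ≡⟨ ∑-allVecs-suc d n (λ _ → 1) ⟩
      ∑[ x ∈ allFin n ] ∑[ v ∈ allVecs d n ] 1     ≡⟨ ∑-cong (allFin n) (λ _ → count d) ⟩
      ∑[ x ∈ allFin n ] (n ^ d)                    ≡⟨ ∑-const (allFin n) (n ^ d) ⟩
      length (allFin n) * n ^ d                    ≡⟨ cong (_* n ^ d) (length-tabulate {n = n} id) ⟩
      n ^ suc d                                    ∎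
      where open ≡-Reasoning

  allVecs-multiplicity : ∀ d n (u : Vec (Fin n) d) → ∑[ p ∈ allVecs d n ] 𝟙 (u ≟ᵛ p) ≡ 1
  allVecs-multiplicity zero    n u@[] = cong (_+ 0) (𝟙-yes refl (u ≟ᵛ u))
  allVecs-multiplicity (suc d) n (x ∷ u) = begin
    ∑[ p ∈ allVecs (suc d) n ] 𝟙 (x ∷ u ≟ᵛ p)                                  ≡⟨ ∑-allVecs-suc d n (λ p → 𝟙 (x ∷ u ≟ᵛ p)) ⟩
    ∑[ y ∈ allFin n ] ∑[ v ∈ allVecs d n ] 𝟙 (x ∷ u ≟ᵛ y ∷ v)                   ≡⟨ ∑-cong (allFin n) (λ y → ∑-cong (allVecs d n) (𝟙-∷ x y u)) ⟩
    ∑[ y ∈ allFin n ] ∑[ v ∈ allVecs d n ] (𝟙 (x Fin.≟ y) * 𝟙 (u ≟ᵛ v))        ≡⟨ ∑-cong (allFin n) (λ y → *-distribˡ-∑ (𝟙 (x Fin.≟ y)) (allVecs d n) (λ v → 𝟙 (u ≟ᵛ v))) ⟨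
    ∑[ y ∈ allFin n ] (𝟙 (x Fin.≟ y) * ∑[ v ∈ allVecs d n ] 𝟙 (u ≟ᵛ v))        ≡⟨ ∑-cong (allFin n) (λ y → cong (𝟙 (x Fin.≟ y) *_) (allVecs-multiplicity d n u)) ⟩
    ∑[ y ∈ allFin n ] (𝟙 (x Fin.≟ y) * 1)                                      ≡⟨ ∑-delta Fin._≟_ (allFin-isEnumeration n) x (λ _ → 1) ⟩
    1                                                                          ∎
    where open ≡-Reasoning

  allVecs-isEnumeration : ∀ d n → IsEnumeration _≟ᵛ_ (allVecs d n)
  allVecs-isEnumeration d n = multiplicity-one (allVecs-multiplicity d n)

module NatArithmetic where

  open import Data.Nat using (ℕ; zero; suc; _+_; _*_; _∸_; _^_; _≤_; z≤n; s≤s)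
  open import Data.Nat.Properties
  open import Data.Nat.Combinatorics using (_C_; nC1≡n; nCk+nC[k+1]≡[n+1]C[k+1])
  open import Data.Nat.Tactic.RingSolver using (solve-∀)
  open import Relation.Binary.PropositionalEquality

  [1+k]^[1+m]≤k^[1+m]+[1+m]*[1+k]^m : ∀ k m → suc k ^ suc m ≤ k ^ suc m + suc m * suc k ^ m
  [1+k]^[1+m]≤k^[1+m]+[1+m]*[1+k]^m k zero = ≤-reflexive (expand k)
    where
    expand : ∀ k → suc k * 1 ≡ k * 1 + 1 * 1
    expand = solve-∀
  [1+k]^[1+m]≤k^[1+m]+[1+m]*[1+k]^m k (suc m) = begin
    suc k * suc k ^ suc m                                       ≤⟨ *-monoʳ-≤ (suc k) ([1+k]^[1+m]≤k^[1+m]+[1+m]*[1+k]^m k m) ⟩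
    suc k * (k ^ suc m + suc m * suc k ^ m)                     ≡⟨ expand k (k ^ suc m) m (suc k ^ m) ⟩
    k * k ^ suc m + (k ^ suc m + suc m * suc k ^ suc m)         ≤⟨ +-monoʳ-≤ (k * k ^ suc m) (+-monoˡ-≤ _ (^-monoˡ-≤ (suc m) (n≤1+n k))) ⟩
    k * k ^ suc m + (suc k ^ suc m + suc m * suc k ^ suc m)     ≡⟨ cong (k * k ^ suc m +_) (+-suc-* (suc k ^ suc m) m) ⟩
    k * k ^ suc m + suc (suc m) * suc k ^ suc m                 ∎
    where
    open ≤-Reasoning
    expand : ∀ k a m b → suc k * (a + suc m * b) ≡ k * a + (a + suc m * (suc k * b))
    expand = solve-∀
    +-suc-* : ∀ a m → a + suc m * a ≡ suc (suc m) * a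
    +-suc-* = solve-∀

  ^-2* : ∀ n d → n ^ (2 * d) ≡ n ^ d * n ^ d
  ^-2* n d = trans (^-distribˡ-+-* n d (d + 0)) (cong (λ e → n ^ d * n ^ e) (+-identityʳ d))

  ^-2*[1+e]∸1 : ∀ n e → n ^ (2 * suc e ∸ 1) ≡ n ^ suc e * n ^ e
  ^-2*[1+e]∸1 n e = trans (^-distribˡ-+-* n e (suc e + 0))
    (trans (cong (λ f → n ^ e * n ^ f) (+-identityʳ (suc e))) (*-comm (n ^ e) (n ^ suc e)))

  n^[1+a]*n^b≡n^a*n^[1+b] : ∀ n a b → n ^ suc a * n ^ b ≡ n ^ a * n ^ suc b
  n^[1+a]*n^b≡n^a*n^[1+b] n a b = regroup n (n ^ a) (n ^ b)
    where
    regroup : ∀ n x y → n * x * y ≡ x * (n * y)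
    regroup = solve-∀

  diagonal-bound : ∀ d n F → n ^ d * (n ∸ 1) ^ d ≤ F → n ^ (2 * d) ≤ F + d * n ^ (2 * d ∸ 1)
  diagonal-bound zero    n       F B≤F = ≤-trans B≤F (m≤m+n F 0)
  diagonal-bound (suc e) zero    F _   = z≤n
  diagonal-bound (suc e) (suc k) F B≤F = begin
    n ^ (2 * suc e)                                     ≡⟨ ^-2* n (suc e) ⟩
    n ^ suc e * n ^ suc e                               ≤⟨ *-monoʳ-≤ (n ^ suc e) ([1+k]^[1+m]≤k^[1+m]+[1+m]*[1+k]^m k e) ⟩
    n ^ suc e * (k ^ suc e + suc e * n ^ e)             ≡⟨ distrib (n ^ suc e) (k ^ suc e) (suc e) (n ^ e) ⟩
    n ^ suc e * k ^ suc e + suc e * (n ^ suc e * n ^ e) ≤⟨ +-mono-≤ B≤F (≤-reflexive (cong (suc e *_) (sym (^-2*[1+e]∸1 n e)))) ⟩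
    F + suc e * n ^ (2 * suc e ∸ 1)                     ∎
    where
    open ≤-Reasoning
    n : ℕ
    n = suc k
    distrib : ∀ a b c e → a * (b + c * e) ≡ a * b + c * (a * e)
    distrib = solve-∀

  square-bound : ∀ d m n F → (n ^ d * (n ∸ 1) ^ m) * (n ^ d * (n ∸ 1) ^ m) ≤ n ^ (2 * m) * F →
                 n ^ (2 * d) ≤ F + 2 * m * n ^ (2 * d ∸ 1)
  square-bound d zero n F B²≤F = begin
    n ^ (2 * d)                   ≡⟨ ^-2* n d ⟩
    n ^ d * n ^ d                 ≡⟨ cong₂ _*_ (*-identityʳ (n ^ d)) (*-identityʳ (n ^ d)) ⟨
    (n ^ d * 1) * (n ^ d * 1)     ≤⟨ B²≤F ⟩
    1 * F                         ≡⟨ *-identityˡ F ⟩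
    F                             ≤⟨ m≤m+n F 0 ⟩
    F + 0                         ∎
    where open ≤-Reasoning
  square-bound zero    (suc m) n       F _ = ≤-trans (s≤s z≤n) (m≤n+m _ F)
  square-bound (suc e) (suc m) zero    F _ = z≤n
  square-bound (suc e) (suc m) (suc k) F B²≤F = *-cancelˡ-≤ (n ^ M) {{m^n≢0 n M}} (begin
    n ^ M * n ^ D                                   ≤⟨ *-monoˡ-≤ (n ^ D) ([1+k]^[1+m]≤k^[1+m]+[1+m]*[1+k]^m k (M ∸ 1)) ⟩
    (k ^ M + M * n ^ (M ∸ 1)) * n ^ D                ≡⟨ distrib (k ^ M) M (n ^ (M ∸ 1)) (n ^ D) ⟩
    k ^ M * n ^ D + M * (n ^ (M ∸ 1) * n ^ D)        ≡⟨ cong₂ (λ a b → a + M * b) B²≡ (n^[1+a]*n^b≡n^a*n^[1+b] n (M ∸ 1) (D ∸ 1)) ⟨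
    B * B + M * (n ^ M * n ^ (D ∸ 1))                ≤⟨ +-monoˡ-≤ _ B²≤F ⟩
    n ^ M * F + M * (n ^ M * n ^ (D ∸ 1))            ≡⟨ factor (n ^ M) F M (n ^ (D ∸ 1)) ⟩
    n ^ M * (F + M * n ^ (D ∸ 1))                    ∎)
    where
    open ≤-Reasoning
    n D M B : ℕ
    n = suc k
    D = 2 * suc e
    M = 2 * suc m
    B = n ^ suc e * k ^ suc m
    B²≡ : B * B ≡ k ^ M * n ^ D
    B²≡ = begin-equality
      B * B                                                   ≡⟨ interchange (n ^ suc e) (k ^ suc m) ⟩
      (k ^ suc m * k ^ suc m) * (n ^ suc e * n ^ suc e)       ≡⟨ cong₂ _*_ (^-2* k (suc m)) (^-2* n (suc e)) ⟨
      k ^ M * n ^ D                                           ∎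
      where
      interchange : ∀ a b → (a * b) * (a * b) ≡ (b * b) * (a * a)
      interchange = solve-∀
    distrib : ∀ a m b c → (a + m * b) * c ≡ a * c + m * (b * c)
    distrib = solve-∀
    factor : ∀ a f m y → a * f + m * (a * y) ≡ a * (f + m * y)
    factor = solve-∀

  2*nC2≡n*[n∸1] : ∀ n → 2 * (n C 2) ≡ n * (n ∸ 1)
  2*nC2≡n*[n∸1] zero    = refl
  2*nC2≡n*[n∸1] (suc n) = begin
    2 * (suc n C 2)             ≡⟨ cong (2 *_) (nCk+nC[k+1]≡[n+1]C[k+1] n 1) ⟨
    2 * ((n C 1) + (n C 2))     ≡⟨ *-distribˡ-+ 2 (n C 1) (n C 2) ⟩
    2 * (n C 1) + 2 * (n C 2)   ≡⟨ cong₂ (λ a b → 2 * a + b) (nC1≡n n) (2*nC2≡n*[n∸1] n) ⟩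
    2 * n + n * (n ∸ 1)         ≡⟨ step n ⟩
    suc n * n                   ∎
    where
    open ≡-Reasoning
    step : ∀ n → 2 * n + n * (n ∸ 1) ≡ suc n * n
    step zero    = refl
    step (suc n) = expand n
      where
      expand : ∀ n → 2 * suc n + suc n * n ≡ suc (suc n) * suc n
      expand = solve-∀

  m*o≤n⇒m*x*o≤n*x : ∀ m o n x → m * o ≤ n → m * x * o ≤ n * x
  m*o≤n⇒m*x*o≤n*x m o n x mo≤n = subst (_≤ n * x) (regroup m o x) (*-monoˡ-≤ x mo≤n)
    where
    regroup : ∀ m o x → m * o * x ≡ m * x * o
    regroup = solve-∀

module Boxes where

  open FiniteSums
  open Enumerations

  open import Data.Nat using (ℕ; zero; suc; _^_)
  open import Data.Fin using (Fin; zero; suc)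
  import Data.Fin.Properties as Fin
  open import Data.List using (List; map; concatMap)
  open import Data.Vec using (Vec; []; _∷_; zipWith; allPairs)
  import Data.Vec as Vec
  import Data.Vec.Properties as Vec
  open import Data.Vec.Relation.Unary.Any using (here; there)
  open import Data.Vec.Membership.Propositional using (_∈_)
  open import Data.Vec.Membership.Propositional.Properties using (∈-map⁺; ∈-allPairs⁺; ∈-allFin⁺)
  open import Data.Product using (_×_; _,_; uncurry)
  open import Function using (_∘_)
  open import Relation.Nullary using (yes; no)
  open import Relation.Binary.PropositionalEquality

  Box : ℕ → ℕ → Set
  Box d n = Vec (Fin n) d × Vec (Fin n) d

  boxes : ∀ d n → List (Box d n)
  boxes d n = concatMap (λ a₁ → map (a₁ ,_) (allVecs d n)) (allVecs d n)

  _⊗_ : ∀ {d n} → Box d n → Box d n → Quad d n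
  (a₁ , a₂) ⊗ (b₁ , b₂) = a₁ , a₂ , b₁ , b₂

  apart : ∀ {n} → Fin n → Fin n → Fin 2
  apart x y with x Fin.≟ y
  ... | yes _ = zero
  ... | no _  = suc zero

  shape : ∀ {d n} → Box d n → Vec (Fin 2) d
  shape (a₁ , a₂) = zipWith apart a₁ a₂

  hasShape : ∀ {d n} → Vec (Fin 2) d → Box d n → ℕ
  hasShape σ a = 𝟙 (shape a ≟ᵛ σ)

  restrict : Fin 2 → Fin 2 → Fin 2
  restrict j zero    = zero
  restrict j (suc _) = j

  weight : ∀ {d} → Vec (Fin 2) d → ℕ
  weight []           = 0
  weight (zero ∷ σ)   = weight σ
  weight (suc _ ∷ σ)  = suc (weight σ)

  -- One vertex selector for each of the (at most) 2 ^ weight σ distinct vertices of a box of shape σ.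
  corners : ∀ {d} (σ : Vec (Fin 2) d) → Vec (Vec (Fin 2) d) (2 ^ weight σ)
  corners []             = [] ∷ []
  corners (zero ∷ σ)     = Vec.map (zero ∷_) (corners σ)
  corners (suc zero ∷ σ) = Vec.map (uncurry _∷_) (allPairs (Vec.allFin 2) (corners σ))

  choose-restrict-apart : ∀ {n} j (x y : Fin n) → choose j x y ≡ choose (restrict j (apart x y)) x y
  choose-restrict-apart j x y with x Fin.≟ y
  choose-restrict-apart zero       x .x | yes refl = refl
  choose-restrict-apart (suc zero) x .x | yes refl = refl
  ... | no _ = refl

  vertex-restrict : ∀ {d n} (a₁ a₂ : Vec (Fin n) d) j → vertex a₁ a₂ j ≡ vertex a₁ a₂ (zipWith restrict j (shape (a₁ , a₂)))
  vertex-restrict []       []       []       = refl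
  vertex-restrict (x ∷ a₁) (y ∷ a₂) (j ∷ js) = cong₂ _∷_ (choose-restrict-apart j x y) (vertex-restrict a₁ a₂ js)

  restrict-∈-corners : ∀ {d} (j σ : Vec (Fin 2) d) → zipWith restrict j σ ∈ corners σ
  restrict-∈-corners []       []             = here refl
  restrict-∈-corners (j ∷ js) (zero ∷ σ)     = ∈-map⁺ (zero ∷_) (restrict-∈-corners js σ)
  restrict-∈-corners (j ∷ js) (suc zero ∷ σ) = ∈-map⁺ (uncurry _∷_) (∈-allPairs⁺ (∈-allFin⁺ j) (restrict-∈-corners js σ))

  map-≡⇒∈⇒≡ : ∀ {A B : Set} {k} (f g : A → B) {xs : Vec A k} {x} → Vec.map f xs ≡ Vec.map g xs → x ∈ xs → f x ≡ g x
  map-≡⇒∈⇒≡ f g {_ ∷ _} eq (here refl) = Vec.∷-injectiveˡ eq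
  map-≡⇒∈⇒≡ f g {_ ∷ _} eq (there x∈) = map-≡⇒∈⇒≡ f g (Vec.∷-injectiveʳ eq) x∈

  trace : ∀ {d n} → Array d n → (σ : Vec (Fin 2) d) → Box d n → Vec (Fin n) (2 ^ weight σ)
  trace Q σ (a₁ , a₂) = Vec.map (Q ∘ vertex a₁ a₂) (corners σ)

  same-trace⇒cuboctahedron : ∀ {d n} (Q : Array d n) {σ} (a b : Box d n) → shape a ≡ σ → shape b ≡ σ →
                             trace Q σ a ≡ trace Q σ b → IsCuboctahedron Q (a ⊗ b)
  same-trace⇒cuboctahedron Q (a₁ , a₂) (b₁ , b₂) refl sb≡sa traces≡ j = begin
    Q (vertex a₁ a₂ j)                                      ≡⟨ cong Q (vertex-restrict a₁ a₂ j) ⟩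
    Q (vertex a₁ a₂ (zipWith restrict j (shape (a₁ , a₂)))) ≡⟨ map-≡⇒∈⇒≡ _ _ traces≡ (restrict-∈-corners j _) ⟩
    Q (vertex b₁ b₂ (zipWith restrict j (shape (a₁ , a₂)))) ≡⟨ cong (λ σ → Q (vertex b₁ b₂ (zipWith restrict j σ))) sb≡sa ⟨
    Q (vertex b₁ b₂ (zipWith restrict j (shape (b₁ , b₂)))) ≡⟨ cong Q (vertex-restrict b₁ b₂ j) ⟨
    Q (vertex b₁ b₂ j)                                      ∎
    where open ≡-Reasoning

module BoxCounts where

  open FiniteSums
  open Enumerations
  open Boxes

  open import Data.Nat using (ℕ; zero; suc; _+_; _*_; _∸_; _^_; _≤_)
  import Data.Nat as ℕ
  open import Data.Nat.Properties
  open import Data.Nat.Tactic.RingSolver using (solve-∀)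
  open import Data.Nat.Combinatorics using (_C_; nCk+nC[k+1]≡[n+1]C[k+1])
  open import Data.Fin using (Fin; zero; suc)
  import Data.Fin.Properties as Fin
  open import Data.List using (length; allFin)
  open import Data.List.Properties using (length-tabulate)
  open import Data.Vec using (Vec; []; _∷_)
  open import Data.Product using (_,_; proj₁; proj₂)
  open import Function using (id)
  open import Relation.Nullary using (yes; no)
  open import Relation.Binary.PropositionalEquality

  module _ {d n : ℕ} where

    ∑-boxes : (f : Box d n → ℕ) → ∑ (boxes d n) f ≡ ∑[ a₁ ∈ allVecs d n ] ∑[ a₂ ∈ allVecs d n ] f (a₁ , a₂)
    ∑-boxes f = trans (∑-concatMap _ (allVecs d n) f) (∑-cong (allVecs d n) (λ a₁ → ∑-map (a₁ ,_) (allVecs d n) f))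

    term-≤-∑-boxes : (a : Box d n) (g : Box d n → ℕ) → g a ≤ ∑ (boxes d n) g
    term-≤-∑-boxes (a₁ , a₂) g = begin
      g (a₁ , a₂)                                            ≤⟨ term-≤-∑ _≟ᵛ_ (allVecs-isEnumeration d n) a₂ (λ b₂ → g (a₁ , b₂)) ⟩
      ∑[ b₂ ∈ allVecs d n ] g (a₁ , b₂)                      ≤⟨ term-≤-∑ _≟ᵛ_ (allVecs-isEnumeration d n) a₁ (λ b₁ → ∑[ b₂ ∈ allVecs d n ] g (b₁ , b₂)) ⟩
      ∑[ b₁ ∈ allVecs d n ] ∑[ b₂ ∈ allVecs d n ] g (b₁ , b₂) ≡⟨ ∑-boxes g ⟨
      ∑ (boxes d n) g                                        ∎
      where open ≤-Reasoning

  ∑-boxes-suc : ∀ {d n} (f : Box (suc d) n → ℕ) →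
    ∑ (boxes (suc d) n) f ≡ ∑[ x ∈ allFin n ] ∑[ y ∈ allFin n ] ∑[ a ∈ boxes d n ] f (x ∷ proj₁ a , y ∷ proj₂ a)
  ∑-boxes-suc {d} {n} f = begin
    ∑ (boxes (suc d) n) f
      ≡⟨ ∑-boxes f ⟩
    ∑[ a₁ ∈ allVecs (suc d) n ] ∑[ a₂ ∈ allVecs (suc d) n ] f (a₁ , a₂)
      ≡⟨ trans (∑-allVecs-suc d n _) (∑-cong (allFin n) (λ x → ∑-cong (allVecs d n) (λ a₁ → ∑-allVecs-suc d n _))) ⟩
    ∑[ x ∈ allFin n ] ∑[ a₁ ∈ allVecs d n ] ∑[ y ∈ allFin n ] ∑[ a₂ ∈ allVecs d n ] f (x ∷ a₁ , y ∷ a₂)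
      ≡⟨ ∑-cong (allFin n) (λ x → ∑-comm (allVecs d n) (allFin n) _) ⟩
    ∑[ x ∈ allFin n ] ∑[ y ∈ allFin n ] ∑[ a₁ ∈ allVecs d n ] ∑[ a₂ ∈ allVecs d n ] f (x ∷ a₁ , y ∷ a₂)
      ≡⟨ ∑-cong (allFin n) (λ x → ∑-cong (allFin n) (λ y → ∑-boxes {d} {n} _)) ⟨
    ∑[ x ∈ allFin n ] ∑[ y ∈ allFin n ] ∑[ a ∈ boxes d n ] f (x ∷ proj₁ a , y ∷ proj₂ a)
      ∎
    where open ≡-Reasoning

  boxesOfShape : ∀ {d} n → Vec (Fin 2) d → ℕ
  boxesOfShape {d} n σ = ∑ (boxes d n) (hasShape σ)

  pairsOfKind : ∀ n → Fin 2 → ℕ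
  pairsOfKind n s = ∑[ x ∈ allFin n ] ∑[ y ∈ allFin n ] 𝟙 (apart x y Fin.≟ s)

  boxesOfShape-∷ : ∀ {d} n s (σ : Vec (Fin 2) d) → boxesOfShape n (s ∷ σ) ≡ pairsOfKind n s * boxesOfShape n σ
  boxesOfShape-∷ {d} n s σ = begin
    boxesOfShape n (s ∷ σ)
      ≡⟨ ∑-boxes-suc {d} {n} _ ⟩
    ∑[ x ∈ allFin n ] ∑[ y ∈ allFin n ] ∑[ a ∈ boxes d n ] 𝟙 (apart x y ∷ shape a ≟ᵛ s ∷ σ)
      ≡⟨ ∑-cong (allFin n) (λ x → ∑-cong (allFin n) (λ y → ∑-cong (boxes d n) (λ a → 𝟙-∷ (apart x y) s (shape a) σ))) ⟩
    ∑[ x ∈ allFin n ] ∑[ y ∈ allFin n ] ∑[ a ∈ boxes d n ] (𝟙 (apart x y Fin.≟ s) * 𝟙 (shape a ≟ᵛ σ))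
      ≡⟨ ∑-cong (allFin n) (λ x → ∑-cong (allFin n) (λ y → *-distribˡ-∑ (𝟙 (apart x y Fin.≟ s)) (boxes d n) (λ a → 𝟙 (shape a ≟ᵛ σ)))) ⟨
    ∑[ x ∈ allFin n ] ∑[ y ∈ allFin n ] (𝟙 (apart x y Fin.≟ s) * boxesOfShape n σ)
      ≡⟨ trans (*-distribʳ-∑ _ (allFin n) _) (∑-cong (allFin n) (λ x → *-distribʳ-∑ _ (allFin n) _)) ⟨
    pairsOfKind n s * boxesOfShape n σ
      ∎
    where open ≡-Reasoning

  𝟙-apart-zero : ∀ {n} (x y : Fin n) → 𝟙 (apart x y Fin.≟ zero) ≡ 𝟙 (x Fin.≟ y)
  𝟙-apart-zero x y with x Fin.≟ y
  ... | yes _ = refl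
  ... | no _  = refl

  𝟙-zero+𝟙-one : (s : Fin 2) → 𝟙 (s Fin.≟ zero) + 𝟙 (s Fin.≟ suc zero) ≡ 1
  𝟙-zero+𝟙-one zero       = refl
  𝟙-zero+𝟙-one (suc zero) = refl

  length-allFin : ∀ n → length (allFin n) ≡ n
  length-allFin n = length-tabulate {n = n} id

  pairsOfKind-zero : ∀ n → pairsOfKind n zero ≡ n
  pairsOfKind-zero n = begin
    ∑[ x ∈ allFin n ] ∑[ y ∈ allFin n ] 𝟙 (apart x y Fin.≟ zero) ≡⟨ ∑-cong (allFin n) (λ x → ∑-cong (allFin n) (𝟙-apart-zero x)) ⟩
    ∑[ x ∈ allFin n ] ∑[ y ∈ allFin n ] 𝟙 (x Fin.≟ y)            ≡⟨ ∑-cong (allFin n) (allFin-multiplicity n) ⟩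
    ∑[ x ∈ allFin n ] 1                                          ≡⟨ ∑-const (allFin n) 1 ⟩
    length (allFin n) * 1                              ≡⟨ cong (_* 1) (length-allFin n) ⟩
    n * 1                                                        ≡⟨ *-identityʳ n ⟩
    n                                                            ∎
    where open ≡-Reasoning

  pairsOfKind-one : ∀ n → pairsOfKind n (suc zero) ≡ n * (n ∸ 1)
  pairsOfKind-one n = begin
    pairsOfKind n (suc zero)                                     ≡⟨ m+n∸m≡n (pairsOfKind n zero) _ ⟨
    pairsOfKind n zero + pairsOfKind n (suc zero) ∸ pairsOfKind n zero ≡⟨ cong₂ _∸_ all-pairs (trans (pairsOfKind-zero n) (sym (*-identityʳ n))) ⟩
    n * n ∸ n * 1                                                ≡⟨ *-distribˡ-∸ n n 1 ⟨
    n * (n ∸ 1)                                                  ∎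
    where
    open ≡-Reasoning
    all-pairs : pairsOfKind n zero + pairsOfKind n (suc zero) ≡ n * n
    all-pairs = begin
      pairsOfKind n zero + pairsOfKind n (suc zero)
        ≡⟨ ∑-distrib-+ (allFin n) _ _ ⟨
      ∑[ x ∈ allFin n ] (∑[ y ∈ allFin n ] 𝟙 (apart x y Fin.≟ zero) + ∑[ y ∈ allFin n ] 𝟙 (apart x y Fin.≟ suc zero))
        ≡⟨ ∑-cong (allFin n) (λ x → trans (sym (∑-distrib-+ (allFin n) _ _)) (∑-cong (allFin n) (λ y → 𝟙-zero+𝟙-one (apart x y)))) ⟩
      ∑[ x ∈ allFin n ] ∑[ y ∈ allFin n ] 1
        ≡⟨ trans (∑-cong (allFin n) (λ x → ∑-const (allFin n) 1)) (∑-const (allFin n) _) ⟩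
      length (allFin n) * (length (allFin n) * 1)
        ≡⟨ cong₂ (λ a b → a * (b * 1)) (length-allFin n) (length-allFin n) ⟩
      n * (n * 1)
        ≡⟨ cong (n *_) (*-identityʳ n) ⟩
      n * n
        ∎

  boxesOfShape≡ : ∀ {d} n (σ : Vec (Fin 2) d) → boxesOfShape n σ ≡ n ^ d * (n ∸ 1) ^ weight σ
  boxesOfShape≡ n [] = cong (_+ 0) (𝟙-yes refl (_≟ᵛ_ {n = n} [] []))
  boxesOfShape≡ {suc d} n (zero ∷ σ) = begin
    boxesOfShape n (zero ∷ σ)             ≡⟨ boxesOfShape-∷ n zero σ ⟩
    pairsOfKind n zero * boxesOfShape n σ ≡⟨ cong₂ _*_ (pairsOfKind-zero n) (boxesOfShape≡ n σ) ⟩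
    n * (n ^ d * (n ∸ 1) ^ weight σ)      ≡⟨ *-assoc n _ _ ⟨
    n ^ suc d * (n ∸ 1) ^ weight σ        ∎
    where open ≡-Reasoning
  boxesOfShape≡ {suc d} n (suc zero ∷ σ) = begin
    boxesOfShape n (suc zero ∷ σ)                 ≡⟨ boxesOfShape-∷ n (suc zero) σ ⟩
    pairsOfKind n (suc zero) * boxesOfShape n σ   ≡⟨ cong₂ _*_ (pairsOfKind-one n) (boxesOfShape≡ n σ) ⟩
    n * (n ∸ 1) * (n ^ d * (n ∸ 1) ^ weight σ)    ≡⟨ interchange n (n ∸ 1) (n ^ d) _ ⟩
    n ^ suc d * (n ∸ 1) ^ suc (weight σ)          ∎
    where
    open ≡-Reasoning
    interchange : ∀ a b c e → a * b * (c * e) ≡ a * c * (b * e)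
    interchange = solve-∀

  ∑-𝟙-weight≡C : ∀ d m → ∑[ σ ∈ allVecs d 2 ] 𝟙 (weight σ ℕ.≟ m) ≡ d C m
  ∑-𝟙-weight≡C zero    zero    = refl
  ∑-𝟙-weight≡C zero    (suc m) = refl
  ∑-𝟙-weight≡C (suc d) m = begin
    ∑[ σ ∈ allVecs (suc d) 2 ] 𝟙 (weight σ ℕ.≟ m)
      ≡⟨ ∑-allVecs-suc d 2 _ ⟩
    ∑[ σ ∈ allVecs d 2 ] 𝟙 (weight σ ℕ.≟ m) + (∑[ σ ∈ allVecs d 2 ] 𝟙 (suc (weight σ) ℕ.≟ m) + 0)
      ≡⟨ cong₂ _+_ (∑-𝟙-weight≡C d m) (+-identityʳ _) ⟩
    d C m + ∑[ σ ∈ allVecs d 2 ] 𝟙 (suc (weight σ) ℕ.≟ m)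
      ≡⟨ pascal m ⟩
    suc d C m
      ∎
    where
    open ≡-Reasoning
    pascal : ∀ m → d C m + ∑[ σ ∈ allVecs d 2 ] 𝟙 (suc (weight σ) ℕ.≟ m) ≡ suc d C m
    pascal zero    = begin
      d C 0 + ∑[ σ ∈ allVecs d 2 ] 𝟙 (suc (weight σ) ℕ.≟ 0)
        ≡⟨ cong (d C 0 +_) (trans (∑-cong (allVecs d 2) (λ σ → 𝟙-no (λ ()) (suc (weight σ) ℕ.≟ 0))) (∑-zero (allVecs d 2))) ⟩
      d C 0 + 0
        ≡⟨ +-identityʳ (d C 0) ⟩
      suc d C 0
        ∎
    pascal (suc m) = begin
      d C suc m + ∑[ σ ∈ allVecs d 2 ] 𝟙 (suc (weight σ) ℕ.≟ suc m)
        ≡⟨ cong (d C suc m +_) (∑-cong (allVecs d 2) (λ σ → 𝟙-cong suc-injective (cong suc) _ (weight σ ℕ.≟ m))) ⟩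
      d C suc m + ∑[ σ ∈ allVecs d 2 ] 𝟙 (weight σ ℕ.≟ m)
        ≡⟨ cong (d C suc m +_) (∑-𝟙-weight≡C d m) ⟩
      d C suc m + d C m
        ≡⟨ +-comm (d C suc m) (d C m) ⟩
      d C m + d C suc m
        ≡⟨ nCk+nC[k+1]≡[n+1]C[k+1] d m ⟩
      suc d C suc m
        ∎

module CuboctahedronCount where

  open FiniteSums
  open Enumerations
  open NatArithmetic
  open Boxes
  open BoxCounts

  open import Data.Nat using (ℕ; _+_; _*_; _∸_; _^_; _≤_; z≤n; s≤s)
  import Data.Nat as ℕ
  open import Data.Nat.Properties
  open import Data.Nat.Tactic.RingSolver using (solve-∀)
  open import Data.Nat.Combinatorics using (_C_; nC1≡n; nCn≡1)
  open import Data.Fin using (Fin)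
  open import Data.List using (List; length; map; concatMap)
  open import Data.Vec using (Vec)
  open import Data.Product using (_,_)
  open import Relation.Nullary using (yes; no)
  open import Relation.Binary.PropositionalEquality

  module _ {d n : ℕ} (Q : Array d n) where

    isCubo : Box d n → Box d n → ℕ
    isCubo a b = 𝟙 (isCuboctahedron? Q (a ⊗ b))

    cuboctahedraOfShape : Vec (Fin 2) d → ℕ
    cuboctahedraOfShape σ = ∑[ a ∈ boxes d n ] ∑[ b ∈ boxes d n ] (hasShape σ a * hasShape σ b * isCubo a b)

    numCuboctahedra≡∑∑ : numCuboctahedra Q ≡ ∑[ a ∈ boxes d n ] ∑[ b ∈ boxes d n ] isCubo a b
    numCuboctahedra≡∑∑ = begin
      numCuboctahedra Q
        ≡⟨ length-filter≡∑𝟙 (isCuboctahedron? Q) (allQuads d n) ⟩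
      ∑ (allQuads d n) cubo
        ≡⟨ ∑-concatMap _ Vs cubo ⟩
      ∑[ a₁ ∈ Vs ] ∑ (concatMap (λ a₂ → concatMap (λ b₁ → map (λ b₂ → a₁ , a₂ , b₁ , b₂) Vs) Vs) Vs) cubo
        ≡⟨ ∑-cong Vs (λ a₁ → trans (∑-concatMap _ Vs cubo) (∑-cong Vs (λ a₂ →
             trans (∑-concatMap _ Vs cubo) (∑-cong Vs (λ b₁ → ∑-map _ Vs cubo))))) ⟩
      ∑[ a₁ ∈ Vs ] ∑[ a₂ ∈ Vs ] ∑[ b₁ ∈ Vs ] ∑[ b₂ ∈ Vs ] cubo (a₁ , a₂ , b₁ , b₂)
        ≡⟨ trans (∑-boxes (λ a → ∑[ b ∈ boxes d n ] isCubo a b)) (∑-cong Vs (λ a₁ → ∑-cong Vs (λ a₂ → ∑-boxes (isCubo (a₁ , a₂))))) ⟨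
      ∑[ a ∈ boxes d n ] ∑[ b ∈ boxes d n ] isCubo a b
        ∎
      where
      open ≡-Reasoning
      Vs : List (Vec (Fin n) d)
      Vs = allVecs d n
      cubo : Quad d n → ℕ
      cubo t = 𝟙 (isCuboctahedron? Q t)

    ∑-cuboctahedraOfShape-≤ : ∑[ σ ∈ allVecs d 2 ] cuboctahedraOfShape σ ≤ numCuboctahedra Q
    ∑-cuboctahedraOfShape-≤ = begin
      ∑[ σ ∈ Σs ] ∑[ a ∈ boxes d n ] ∑[ b ∈ boxes d n ] (hasShape σ a * hasShape σ b * isCubo a b)
        ≡⟨ trans (∑-comm Σs (boxes d n) _) (∑-cong (boxes d n) (λ a → ∑-comm Σs (boxes d n) _)) ⟩
      ∑[ a ∈ boxes d n ] ∑[ b ∈ boxes d n ] ∑[ σ ∈ Σs ] (hasShape σ a * hasShape σ b * isCubo a b)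
        ≤⟨ ∑-mono-≤ (boxes d n) (λ a → ∑-mono-≤ (boxes d n) (same-shape-≤ a)) ⟩
      ∑[ a ∈ boxes d n ] ∑[ b ∈ boxes d n ] isCubo a b
        ≡⟨ numCuboctahedra≡∑∑ ⟨
      numCuboctahedra Q
        ∎
      where
      open ≤-Reasoning
      Σs : List (Vec (Fin 2) d)
      Σs = allVecs d 2
      same-shape-≤ : ∀ a b → ∑[ σ ∈ Σs ] (hasShape σ a * hasShape σ b * isCubo a b) ≤ isCubo a b
      same-shape-≤ a b = begin
        ∑[ σ ∈ Σs ] (hasShape σ a * hasShape σ b * isCubo a b)   ≡⟨ ∑-cong Σs (λ σ → *-assoc (hasShape σ a) _ _) ⟩
        ∑[ σ ∈ Σs ] (hasShape σ a * (hasShape σ b * isCubo a b)) ≡⟨ ∑-delta _≟ᵛ_ (allVecs-isEnumeration d 2) (shape a) _ ⟩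
        hasShape (shape a) b * isCubo a b                         ≤⟨ 𝟙*-≤ (shape b ≟ᵛ shape a) _ ⟩
        isCubo a b                                                ∎

    boxesOfShape-≤ : ∀ σ → boxesOfShape n σ ≤ cuboctahedraOfShape σ
    boxesOfShape-≤ σ = ∑-mono-≤ (boxes d n) (λ a → ≤-trans (diagonal a)
      (term-≤-∑-boxes a (λ b → hasShape σ a * hasShape σ b * isCubo a b)))
      where
      diagonal : ∀ a → hasShape σ a ≤ hasShape σ a * hasShape σ a * isCubo a a
      diagonal a@(a₁ , a₂) rewrite 𝟙-yes (λ j → refl) (isCuboctahedron? Q (a ⊗ a)) with shape a ≟ᵛ σ
      ... | yes _ = ≤-refl
      ... | no _  = ≤-refl

    boxesOfShape²-≤ : ∀ σ → boxesOfShape n σ * boxesOfShape n σ ≤ n ^ 2 ^ weight σ * cuboctahedraOfShape σ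
    boxesOfShape²-≤ σ = begin
      boxesOfShape n σ * boxesOfShape n σ
        ≤⟨ collision-bound _≟ᵛ_ (allVecs-isEnumeration (2 ^ weight σ) n) (boxes d n) (hasShape σ) (trace Q σ) ⟩
      length (allVecs (2 ^ weight σ) n) * collisions _≟ᵛ_ (allVecs-isEnumeration (2 ^ weight σ) n) (boxes d n) (hasShape σ) (trace Q σ)
        ≤⟨ *-mono-≤ (≤-reflexive (length-allVecs (2 ^ weight σ) n)) (∑-mono-≤ (boxes d n) (λ a → ∑-mono-≤ (boxes d n) (same-trace-≤ a))) ⟩
      n ^ 2 ^ weight σ * cuboctahedraOfShape σ
        ∎
      where
      open ≤-Reasoning
      same-trace-≤ : ∀ a b → hasShape σ a * hasShape σ b * 𝟙 (trace Q σ a ≟ᵛ trace Q σ b) ≤ hasShape σ a * hasShape σ b * isCubo a b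
      same-trace-≤ a b with shape a ≟ᵛ σ | shape b ≟ᵛ σ | trace Q σ a ≟ᵛ trace Q σ b
      ... | yes sa | yes sb | yes t = ≤-reflexive (cong (1 * 1 *_) (sym (𝟙-yes (same-trace⇒cuboctahedron Q a b sa sb t) (isCuboctahedron? Q (a ⊗ b)))))
      ... | yes _  | yes _  | no _  = z≤n
      ... | yes _  | no _   | _     = z≤n
      ... | no _   | _      | _     = z≤n

    private
      F : Vec (Fin 2) d → ℕ
      F = cuboctahedraOfShape
      X Y : ℕ
      X = n ^ (2 * d)
      Y = n ^ (2 * d ∸ 1)
      Σs : List (Vec (Fin 2) d)
      Σs = allVecs d 2

    layer : ℕ → ℕ
    layer m = ∑[ σ ∈ Σs ] (𝟙 (weight σ ℕ.≟ m) * F σ)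

    -- B² / n ^ 2 ^ m has order n ^ (2 d + 2 m ∸ 2 ^ m), which is n ^ (2 d) only for m ∈ {1, 2}.
    small-shape-bound : ∀ σ → 2 ^ weight σ ≡ 2 * weight σ → X ≤ F σ + 2 * weight σ * Y
    small-shape-bound σ 2^w≡2w = square-bound d (weight σ) n (F σ)
      (subst₂ _≤_ (cong₂ _*_ (boxesOfShape≡ n σ) (boxesOfShape≡ n σ)) (cong (λ e → n ^ e * F σ) 2^w≡2w)
        (boxesOfShape²-≤ σ))

    full-shape-bound : ∀ σ → weight σ ≡ d → X ≤ F σ + d * Y
    full-shape-bound σ w≡d = diagonal-bound d n (F σ)
      (subst (_≤ F σ) (trans (boxesOfShape≡ n σ) (cong (λ w → n ^ d * (n ∸ 1) ^ w) w≡d)) (boxesOfShape-≤ σ))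

    layer-bound : ∀ m c → (∀ σ → weight σ ≡ m → X ≤ F σ + c * Y) → (d C m) * X ≤ layer m + (d C m) * (c * Y)
    layer-bound m c bound = subst₂ (λ k l → k * X ≤ layer m + l * (c * Y)) (∑-𝟙-weight≡C d m) (∑-𝟙-weight≡C d m)
      (∑-𝟙-bound (λ σ → weight σ ℕ.≟ m) Σs bound)

    layers-≤ : 3 ≤ d → layer 1 + layer 2 + layer d ≤ numCuboctahedra Q
    layers-≤ 3≤d = begin
      layer 1 + layer 2 + layer d
        ≡⟨ cong (_+ layer d) (∑-distrib-+ Σs _ _) ⟨
      ∑[ σ ∈ Σs ] (𝟙 (weight σ ℕ.≟ 1) * F σ + 𝟙 (weight σ ℕ.≟ 2) * F σ) + layer d
        ≡⟨ ∑-distrib-+ Σs _ _ ⟨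
      ∑[ σ ∈ Σs ] (𝟙 (weight σ ℕ.≟ 1) * F σ + 𝟙 (weight σ ℕ.≟ 2) * F σ + 𝟙 (weight σ ℕ.≟ d) * F σ)
        ≤⟨ ∑-mono-≤ Σs (λ σ → ≤-trans (≤-reflexive (factor (𝟙 (weight σ ℕ.≟ 1)) (𝟙 (weight σ ℕ.≟ 2)) (𝟙 (weight σ ℕ.≟ d)) (F σ))) (*-monoˡ-≤ (F σ) (disjoint (weight σ)))) ⟩
      ∑[ σ ∈ Σs ] (1 * F σ)
        ≡⟨ ∑-cong Σs (λ σ → *-identityˡ (F σ)) ⟩
      ∑ Σs F
        ≤⟨ ∑-cuboctahedraOfShape-≤ ⟩
      numCuboctahedra Q
        ∎
      where
      open ≤-Reasoning
      factor : ∀ a b c f → a * f + b * f + c * f ≡ (a + b + c) * f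
      factor = solve-∀
      disjoint : ∀ w → 𝟙 (w ℕ.≟ 1) + 𝟙 (w ℕ.≟ 2) + 𝟙 (w ℕ.≟ d) ≤ 1
      disjoint = 𝟙-≟-disjoint (λ ()) (<⇒≢ (≤-trans (s≤s (s≤s z≤n)) 3≤d)) (<⇒≢ 3≤d)

    small-layer-bound : ∀ m → 2 ^ m ≡ 2 * m → (d C m) * X ≤ layer m + (d C m) * (2 * m * Y)
    small-layer-bound m 2^m≡2m = layer-bound m (2 * m) λ σ w≡m →
      subst (λ w → X ≤ F σ + 2 * w * Y) w≡m (small-shape-bound σ (subst (λ w → 2 ^ w ≡ 2 * w) (sym w≡m) 2^m≡2m))

    cuboctahedra-lower-bound : 3 ≤ d → (d C 2 + (d + 1)) * X ≤ numCuboctahedra Q + (3 * d + 4 * (d C 2)) * Y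
    cuboctahedra-lower-bound 3≤d = begin
      (d C 2 + (d + 1)) * X
        ≡⟨ split-coefficient ⟩
      (d C 1) * X + (d C 2) * X + (d C d) * X
        ≤⟨ +-mono-≤ (+-mono-≤ (small-layer-bound 1 refl) (small-layer-bound 2 refl)) (layer-bound d d full-shape-bound) ⟩
      (layer 1 + (d C 1) * (2 * Y)) + (layer 2 + (d C 2) * (4 * Y)) + (layer d + (d C d) * (d * Y))
        ≡⟨ regroup (layer 1) (layer 2) (layer d) _ _ _ ⟩
      (layer 1 + layer 2 + layer d) + ((d C 1) * (2 * Y) + (d C 2) * (4 * Y) + (d C d) * (d * Y))
        ≤⟨ +-monoˡ-≤ _ (layers-≤ 3≤d) ⟩
      numCuboctahedra Q + ((d C 1) * (2 * Y) + (d C 2) * (4 * Y) + (d C d) * (d * Y))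
        ≡⟨ cong (numCuboctahedra Q +_) error-coefficient ⟩
      numCuboctahedra Q + (3 * d + 4 * (d C 2)) * Y
        ∎
      where
      open ≤-Reasoning
      regroup : ∀ a b c u v w → (a + u) + (b + v) + (c + w) ≡ (a + b + c) + (u + v + w)
      regroup = solve-∀
      split-coefficient : (d C 2 + (d + 1)) * X ≡ (d C 1) * X + (d C 2) * X + (d C d) * X
      split-coefficient rewrite nC1≡n d | nCn≡1 d = expand (d C 2) d X
        where
        expand : ∀ c d x → (c + (d + 1)) * x ≡ d * x + c * x + 1 * x
        expand = solve-∀
      error-coefficient : (d C 1) * (2 * Y) + (d C 2) * (4 * Y) + (d C d) * (d * Y) ≡ (3 * d + 4 * (d C 2)) * Y
      error-coefficient rewrite nC1≡n d | nCn≡1 d = expand (d C 2) d Y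
        where
        expand : ∀ c d y → d * (2 * y) + c * (4 * y) + 1 * (d * y) ≡ (3 * d + 4 * c) * y
        expand = solve-∀

module RationalBounds where

  open NatArithmetic

  open import Data.Nat using (ℕ; suc; _+_; _*_; _∸_; _^_; z≤n)
  import Data.Nat as ℕ
  import Data.Nat.Properties as ℕ
  open import Data.Nat.Combinatorics using (_C_)
  open import Data.Integer using (+_; +[1+_]; -[1+_]; +0)
  import Data.Integer as ℤ
  import Data.Integer.Properties as ℤ
  open import Data.Rational using (ℚ; mkℚ; 0ℚ; _/_; ∣_∣; -_; toℚᵘ)
  import Data.Rational as ℚ
  import Data.Rational.Properties as ℚ
  open import Data.Rational.Unnormalised using (mkℚᵘ; *≡*; *≤*)
  import Data.Rational.Unnormalised as ℚᵘ
  import Data.Rational.Unnormalised.Properties as ℚᵘ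
  open import Data.Product using (_,_)
  open import Relation.Binary.PropositionalEquality

  toℚᵘ-toℚ : ∀ m → toℚᵘ (toℚ m) ℚᵘ.≃ mkℚᵘ (+ m) 0
  toℚᵘ-toℚ m = ℚ.toℚᵘ-fromℚᵘ (mkℚᵘ (+ m) 0)

  toℚ-+ : ∀ a b → toℚ a ℚ.+ toℚ b ≡ toℚ (a + b)
  toℚ-+ a b = ℚ.toℚᵘ-injective (ℚᵘ.≃-trans (ℚ.toℚᵘ-homo-+ (toℚ a) (toℚ b))
    (ℚᵘ.≃-trans (ℚᵘ.+-cong (toℚᵘ-toℚ a) (toℚᵘ-toℚ b)) (ℚᵘ.≃-trans (*≡* cross) (ℚᵘ.≃-sym (toℚᵘ-toℚ (a + b))))))
    where
    cross : (+ a ℤ.* + 1 ℤ.+ + b ℤ.* + 1) ℤ.* + 1 ≡ + (a + b) ℤ.* + 1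
    cross rewrite ℤ.*-identityʳ (+ a) | ℤ.*-identityʳ (+ b) = cong (ℤ._* + 1) (sym (ℤ.pos-+ a b))

  toℚ-* : ∀ a b → toℚ a ℚ.* toℚ b ≡ toℚ (a * b)
  toℚ-* a b = ℚ.toℚᵘ-injective (ℚᵘ.≃-trans (ℚ.toℚᵘ-homo-* (toℚ a) (toℚ b))
    (ℚᵘ.≃-trans (ℚᵘ.*-cong (toℚᵘ-toℚ a) (toℚᵘ-toℚ b)) (ℚᵘ.≃-trans (*≡* cross) (ℚᵘ.≃-sym (toℚᵘ-toℚ (a * b))))))
    where
    cross : (+ a ℤ.* + b) ℤ.* + 1 ≡ + (a * b) ℤ.* + 1
    cross = cong (ℤ._* + 1) (sym (ℤ.pos-* a b))

  toℚ-mono-≤ : ∀ {a b} → a ℕ.≤ b → toℚ a ℚ.≤ toℚ b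
  toℚ-mono-≤ {a} {b} a≤b = ℚ.toℚᵘ-cancel-≤
    (ℚᵘ.≤-respˡ-≃ (ℚᵘ.≃-sym (toℚᵘ-toℚ a)) (ℚᵘ.≤-respʳ-≃ (ℚᵘ.≃-sym (toℚᵘ-toℚ b)) (*≤* cross)))
    where
    cross : + a ℤ.* + 1 ℤ.≤ + b ℤ.* + 1
    cross rewrite ℤ.*-identityʳ (+ a) | ℤ.*-identityʳ (+ b) = ℤ.+≤+ a≤b

  [2*c]/2≡toℚc : ∀ c → + (2 * c) / 2 ≡ toℚ c
  [2*c]/2≡toℚc c = ℚ.toℚᵘ-injective (ℚᵘ.≃-trans (ℚ.toℚᵘ-fromℚᵘ (mkℚᵘ (+ (2 * c)) 1))
    (ℚᵘ.≃-trans (*≡* cross) (ℚᵘ.≃-sym (toℚᵘ-toℚ c))))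
    where
    cross : + (2 * c) ℤ.* + 1 ≡ + c ℤ.* + 2
    cross rewrite ℤ.*-identityʳ (+ (2 * c)) = trans (cong +_ (ℕ.*-comm 2 c)) (ℤ.pos-* c 2)

  *-≤-+⇒toℚ-*-≤ : ∀ a b c e → a * b ℕ.≤ c + e → toℚ a ℚ.* toℚ b ℚ.+ - toℚ e ℚ.≤ toℚ c
  *-≤-+⇒toℚ-*-≤ a b c e ab≤c+e = begin
    toℚ a ℚ.* toℚ b ℚ.+ - toℚ e     ≡⟨ cong (ℚ._+ - toℚ e) (toℚ-* a b) ⟩
    toℚ (a * b) ℚ.+ - toℚ e         ≤⟨ ℚ.+-monoˡ-≤ (- toℚ e) (toℚ-mono-≤ ab≤c+e) ⟩
    toℚ (c + e) ℚ.+ - toℚ e         ≡⟨ cong (ℚ._+ - toℚ e) (toℚ-+ c e) ⟨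
    toℚ c ℚ.+ toℚ e ℚ.+ - toℚ e     ≡⟨ ℚ.+-assoc (toℚ c) (toℚ e) (- toℚ e) ⟩
    toℚ c ℚ.+ (toℚ e ℚ.+ - toℚ e)   ≡⟨ cong (toℚ c ℚ.+_) (ℚ.+-inverseʳ (toℚ e)) ⟩
    toℚ c ℚ.+ 0ℚ                    ≡⟨ ℚ.+-identityʳ (toℚ c) ⟩
    toℚ c                           ∎
    where open ℚ.≤-Reasoning

  -- For ε = (1 + a) / (1 + D) the threshold N = K (1 + D) works.
  -K*n^k-isLittleO : ∀ K k → IsLittleO (λ n → - toℚ (K * n ^ k)) (suc k)
  -K*n^k-isLittleO K k (mkℚ +0         _ _) (ℚ.*<* (ℤ.+<+ ()))
  -K*n^k-isLittleO K k (mkℚ -[1+ _ ]   _ _) (ℚ.*<* ())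
  -K*n^k-isLittleO K k ε@(mkℚ +[1+ a ] D _) _ = K * suc D , bound
    where
    bound : ∀ n → K * suc D ℕ.≤ n → ∣ - toℚ (K * n ^ k) ∣ ℚ.≤ ε ℚ.* toℚ (n ^ suc k)
    bound n N≤n = begin
      ∣ - toℚ (K * n ^ k) ∣       ≡⟨ ℚ.∣-p∣≡∣p∣ (toℚ (K * n ^ k)) ⟩
      ∣ toℚ (K * n ^ k) ∣         ≡⟨ ℚ.0≤p⇒∣p∣≡p (toℚ-mono-≤ {0} {K * n ^ k} z≤n) ⟩
      toℚ (K * n ^ k)             ≤⟨ ℚ.toℚᵘ-cancel-≤ (ℚᵘ.≤-respˡ-≃ (ℚᵘ.≃-sym (toℚᵘ-toℚ (K * n ^ k))) (ℚᵘ.≤-respʳ-≃ (ℚᵘ.≃-sym toℚᵘ-ε*n^[1+k]) (*≤* cross))) ⟩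
      ε ℚ.* toℚ (n ^ suc k)       ∎
      where
      open ℚ.≤-Reasoning
      toℚᵘ-ε*n^[1+k] : toℚᵘ (ε ℚ.* toℚ (n ^ suc k)) ℚᵘ.≃ mkℚᵘ +[1+ a ] D ℚᵘ.* mkℚᵘ (+ (n ^ suc k)) 0
      toℚᵘ-ε*n^[1+k] = ℚᵘ.≃-trans (ℚ.toℚᵘ-homo-* ε (toℚ (n ^ suc k))) (ℚᵘ.*-cong (ℚᵘ.≃-refl {mkℚᵘ +[1+ a ] D}) (toℚᵘ-toℚ (n ^ suc k)))
      K*n^k*[1+D]≤[1+a]*n^[1+k] : K * n ^ k * suc D ℕ.≤ suc a * n ^ suc k
      K*n^k*[1+D]≤[1+a]*n^[1+k] = ℕ.≤-trans (m*o≤n⇒m*x*o≤n*x K (suc D) n (n ^ k) N≤n) (ℕ.m≤n*m (n ^ suc k) (suc a))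
      cross : + (K * n ^ k) ℤ.* + (suc D * 1) ℤ.≤ (+[1+ a ] ℤ.* + (n ^ suc k)) ℤ.* + 1
      cross rewrite ℕ.*-identityʳ (suc D) | ℤ.*-identityʳ (+[1+ a ] ℤ.* + (n ^ suc k))
                  | sym (ℤ.pos-* (K * n ^ k) (suc D)) | sym (ℤ.pos-* (suc a) (n ^ suc k)) = ℤ.+≤+ K*n^k*[1+D]≤[1+a]*n^[1+k]

  cuboConst≡toℚ : ∀ d → cuboConst d ≡ toℚ (d C 2 + (d + 1))
  cuboConst≡toℚ d = begin
    + (d * (d ∸ 1)) / 2 ℚ.+ toℚ (d + 1)   ≡⟨ cong (λ m → + m / 2 ℚ.+ toℚ (d + 1)) (2*nC2≡n*[n∸1] d) ⟨
    + (2 * (d C 2)) / 2 ℚ.+ toℚ (d + 1)   ≡⟨ cong (ℚ._+ toℚ (d + 1)) ([2*c]/2≡toℚc (d C 2)) ⟩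
    toℚ (d C 2) ℚ.+ toℚ (d + 1)           ≡⟨ toℚ-+ (d C 2) (d + 1) ⟩
    toℚ (d C 2 + (d + 1))                 ∎
    where open ≡-Reasoning

open import Data.Nat using (ℕ; _^_)
import Data.Nat
open import Data.Product using (Σ; _×_)
open import Data.Rational using (ℚ; _≤_; _+_; _*_)

import Data.Nat as ℕ
open import Data.Nat using (_∸_; s≤s)
open import Data.Nat.Combinatorics using (_C_)
open import Data.Product using (_,_)
open import Data.Rational using (-_)
import Data.Rational.Properties as ℚ
open import Relation.Binary.PropositionalEquality using (cong)
open CuboctahedronCount using (cuboctahedra-lower-bound)
open RationalBounds using (cuboConst≡toℚ; *-≤-+⇒toℚ-*-≤; -K*n^k-isLittleO)

corollary1 : (d : ℕ) → 3 Data.Nat.≤ d →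
    Σ (ℕ → ℚ) λ f → IsLittleO f (2 Data.Nat.* d) ×
      ((n : ℕ) (Q : Array d n) → IsLatinHypercube d n Q →
        cuboConst d * toℚ (n ^ (2 Data.Nat.* d)) + f n ≤ toℚ (numCuboctahedra Q))
-- Matching d = 3 + e makes 2 d and suc (2 d ∸ 1) definitionally equal.
corollary1 d 3≤d@(s≤s (s≤s (s≤s _))) = error , -K*n^k-isLittleO K (2 ℕ.* d ∸ 1) , bound
  where
  K : ℕ
  K = 3 ℕ.* d ℕ.+ 4 ℕ.* (d C 2)
  error : ℕ → ℚ
  error n = - toℚ (K ℕ.* n ^ (2 ℕ.* d ∸ 1))
  bound : (n : ℕ) (Q : Array d n) → IsLatinHypercube d n Q →
          cuboConst d * toℚ (n ^ (2 ℕ.* d)) + error n ≤ toℚ (numCuboctahedra Q)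
  bound n Q _ = ℚ.≤-trans (ℚ.≤-reflexive (cong (λ c → c * toℚ (n ^ (2 ℕ.* d)) + error n) (cuboConst≡toℚ d)))
    (*-≤-+⇒toℚ-*-≤ (d C 2 ℕ.+ (d ℕ.+ 1)) (n ^ (2 ℕ.* d)) (numCuboctahedra Q) (K ℕ.* n ^ (2 ℕ.* d ∸ 1))
      (cuboctahedra-lower-bound Q 3≤d))
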